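{- Let $n = p_1^{k_1} p_2^{k_2} \cdots p_r^{k_r}$ be the prime factorization of a positive integer $n$, with distinct primes $p_i$ and integers $k_i \ge 1$, and let $D = \prod_{i=1}^r (k_i+1)$ be the number of divisors of $n$. Then the Harary index of the divisor prime graph $G_{Dp(n)}$ is $$H(G_{Dp(n)}) = \frac{D(D-1) + \prod_{i=1}^r (2k_i+1) - 1}{4}.$$
   Context: For a positive integer $n$, the divisor prime graph $G_{Dp(n)}$ is the simple graph whose vertex set is the set of positive divisors of $n$, in which two distinct vertices $x, y$ are adjacent if and only if $\gcd(x,y) = 1$ (no loops). For a connected graph $G$, $d(u,v)$ denotes the shortest-path distance, and the Harary index is $H(G) = \sum_{\{u,v\}} \frac{1}{d(u,v)}$, the sum over all unordered pairs of distinct vertices. -}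

module Defs where

open import Data.Nat as ℕ using (ℕ; zero; suc; _≤_; _^_)
open import Data.Nat.Divisibility using (_∣?_)
open import Data.Nat.GCD using (gcd)
open import Data.Nat.Primality using (Prime)
open import Data.List using (List; []; _∷_; map; _++_; filter; applyUpTo; foldr)
open import Data.Nat.ListAction using (product)
open import Data.List.Membership.Propositional using (_∈_)
open import Data.List.Relation.Unary.All using (All)
open import Data.List.Relation.Unary.Unique.Propositional using (Unique)
open import Data.Product using (_×_; _,_; ∃-syntax; proj₁)
open import Data.Integer as ℤ using (ℤ; +_)
open import Data.Rational as ℚ using (ℚ; 0ℚ)
open import Relation.Binary.PropositionalEquality using (_≡_; _≢_)

Divisors : ℕ → List ℕ
Divisors n = filter (_∣? n) (applyUpTo suc n)

Adj : ℕ → ℕ → ℕ → Set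
Adj n x y = (x ∈ Divisors n) × (y ∈ Divisors n) × (x ≢ y) × (gcd x y ≡ 1)

data Walk (n : ℕ) : ℕ → ℕ → ℕ → Set where
  here : ∀ {u} → Walk n u u zero
  step : ∀ {u w v k} → Adj n u w → Walk n w v k → Walk n u v (suc k)

IsDistance : ℕ → (ℕ → ℕ → ℕ) → Set
IsDistance n d = ∀ u v → u ∈ Divisors n → v ∈ Divisors n → u ≢ v →
  Walk n u v (d u v) × (∀ k → Walk n u v k → d u v ≤ k)

pairs : {A : Set} → List A → List (A × A)
pairs [] = []
pairs (x ∷ xs) = map (x ,_) xs ++ pairs xs

-- 1/k as a rational (with the harmless convention 1/0 = 0; distances between
-- distinct vertices are ≥ 1 so this never matters).
recip : ℕ → ℚ
recip zero = 0ℚ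
recip (suc k) = ℤ.+ 1 ℚ./ suc k

sumℚ : List ℚ → ℚ
sumℚ = foldr ℚ._+_ 0ℚ

Harary : ℕ → (ℕ → ℕ → ℕ) → ℚ
Harary n d = sumℚ (map (λ { (u , v) → recip (d u v) }) (pairs (Divisors n)))

IsPrimeFactorization : ℕ → List (ℕ × ℕ) → Set
IsPrimeFactorization n fs =
  All (λ pk → Prime (proj₁ pk) × 1 ≤ Data.Product.proj₂ pk) fs ×
  Unique (map proj₁ fs) ×
  n ≡ product (map (λ { (p , k) → p ^ k }) fs)

numDiv : List (ℕ × ℕ) → ℕ
numDiv fs = product (map (λ { (p , k) → suc k }) fs)

prodOdd : List (ℕ × ℕ) → ℕ
prodOdd fs = product (map (λ { (p , k) → suc (2 ℕ.* k) }) fs)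

hararyFormula : List (ℕ × ℕ) → ℚ
hararyFormula fs =
  ((+ numDiv fs ℤ.* (+ numDiv fs ℤ.- + 1)) ℤ.+ + prodOdd fs ℤ.- + 1) ℚ./ 4

-- Vertex 1 is adjacent to every other divisor, so two distinct divisors are at distance 1
-- when coprime and 2 otherwise: 1/d(x,y) = (1 + [x, y coprime])/2.  Summing over ordered
-- pairs, 4H = (D² − D) + (C − 1), where C counts the ordered coprime pairs of divisors
-- (on the diagonal only (1,1) is coprime).  The divisors of p^k·m are those of m times
-- 1, p, …, p^k, and a coprime pair carries a power of p on at most one side, so each
-- prime power p^k multiplies C by 2k + 1.

module Submission where

open import Defs
open import Algebra.Properties.CommutativeSemigroup using (interchange)
open import Data.Integer as ℤ using (ℤ)
import Data.Integer.Properties as ℤ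
import Data.Integer.Tactic.RingSolver as ℤ-Solver
open import Data.List using (List; []; _∷_; _++_; map; length; applyUpTo)
open import Data.List.Properties using (map-++; map-∘; map-cong; map-cong-local; length-++; length-map)
open import Data.List.Membership.Propositional using (_∈_)
open import Data.List.Membership.Propositional.Properties
  using (∈-map⁺; ∈-map⁻; ∈-++⁺ˡ; ∈-++⁺ʳ; ∈-++⁻; ∈-applyUpTo⁺; ∈-filter⁺; ∈-filter⁻)
open import Data.List.Membership.Propositional.Properties.WithK using (unique∧set⇒bag)
open import Data.List.Relation.Binary.BagAndSetEquality using (∼bag⇒↭)
open import Data.List.Relation.Binary.Permutation.Propositional using (_↭_)
import Data.List.Relation.Binary.Permutation.Propositional.Properties as ↭
open import Data.List.Relation.Unary.All as All using (All; []; _∷_)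
open import Data.List.Relation.Unary.AllPairs using ([]; _∷_)
open import Data.List.Relation.Unary.Any using (here; there)
open import Data.List.Relation.Unary.Unique.Propositional using (Unique)
import Data.List.Relation.Unary.Unique.Propositional.Properties as Unique
open import Data.Nat using (ℕ; zero; suc; _+_; _*_; _^_; _≤_; z≤n; s≤s; NonZero; nonTrivial⇒≢1; ≢-nonZero⁻¹)
open import Data.Nat.Coprimality as Coprime using (Coprime; coprime?; coprime-divisor; coprime⇒gcd≡1; gcd≡1⇒coprime; 1-coprimeTo)
open import Data.Nat.Divisibility
  using (_∣_; _∤_; _∣?_; divides; ∣-refl; ∣-trans; ∣1⇒≡1; ∣⇒≤; 0∣⇒≡0; 1∣_; m∣m*n; ∣n⇒∣m*n; *-monoʳ-∣; *-cancelˡ-∣)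
open import Data.Nat.GCD using (gcd-zeroˡ; gcd-zeroʳ)
open import Data.Nat.ListAction using (sum; product)
open import Data.Nat.ListAction.Properties using (sum-++; sum-↭)
open import Data.Nat.Primality using (Prime; prime⇒irreducible; prime⇒nonZero; prime⇒nonTrivial; euclidsLemma)
open import Data.Nat.Properties
  using (+-commutativeSemigroup; +-comm; +-identityʳ; *-identityˡ; *-identityʳ; *-zeroʳ; *-comm; *-assoc;
         *-cancelˡ-≡; m*n≢0; m^n≢0; <⇒≢; suc-injective)
import Data.Nat.Tactic.RingSolver as ℕ-Solver
open import Data.Product using (_×_; _,_; ∃-syntax; proj₁; proj₂; uncurry)
open import Data.Rational as ℚ using (ℚ; _/_)
import Data.Rational.Properties as ℚ
open import Data.Rational.Unnormalised as ℚᵘ using (mkℚᵘ; *≡*)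
import Data.Rational.Unnormalised.Properties as ℚᵘ
open import Data.Empty using (⊥-elim)
open import Data.Sum using (inj₁; inj₂)
open import Function using (_∘_)
open import Function.Bundles using (mk⇔)
open import Relation.Nullary using (¬_; yes; no; contradiction)
open import Relation.Binary.PropositionalEquality using (_≡_; _≢_; refl; sym; trans; cong; cong₂; subst; subst₂; module ≡-Reasoning)

private variable
  A B : Set

∑ : List A → (A → ℕ) → ℕ
∑ xs f = sum (map f xs)

syntax ∑ xs (λ x → e) = ∑[ x ∈ xs ] e

∑-++ : ∀ xs ys (f : A → ℕ) → ∑ (xs ++ ys) f ≡ ∑ xs f + ∑ ys f
∑-++ xs ys f = trans (cong sum (map-++ f xs ys)) (sum-++ (map f xs) (map f ys))

∑-map : ∀ (g : B → A) xs (f : A → ℕ) → ∑ (map g xs) f ≡ ∑ xs (f ∘ g)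
∑-map g xs f = cong sum (sym (map-∘ xs))

∑-cong : ∀ xs {f g : A → ℕ} → (∀ {x} → x ∈ xs → f x ≡ g x) → ∑ xs f ≡ ∑ xs g
∑-cong xs f≡g = cong sum (map-cong-local (All.tabulate f≡g))

∑-const : ∀ (xs : List A) c → ∑[ x ∈ xs ] c ≡ length xs * c
∑-const []       c = refl
∑-const (_ ∷ xs) c = cong (c +_) (∑-const xs c)

∑-zero : ∀ xs {f : A → ℕ} → (∀ {x} → x ∈ xs → f x ≡ 0) → ∑ xs f ≡ 0
∑-zero xs f≡0 = trans (∑-cong xs f≡0) (trans (∑-const xs 0) (*-zeroʳ (length xs)))

∑-+ : ∀ xs (f g : A → ℕ) → ∑[ x ∈ xs ] (f x + g x) ≡ ∑ xs f + ∑ xs g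
∑-+ []       f g = refl
∑-+ (x ∷ xs) f g = trans (cong (f x + g x +_) (∑-+ xs f g))
                        (interchange +-commutativeSemigroup (f x) (g x) (∑ xs f) (∑ xs g))

∑-↭ : ∀ {xs ys} (f : A → ℕ) → xs ↭ ys → ∑ xs f ≡ ∑ ys f
∑-↭ f xs↭ys = sum-↭ (↭.map⁺ f xs↭ys)

∑-comm : ∀ xs ys (f : A → B → ℕ) →
         ∑[ x ∈ xs ] ∑[ y ∈ ys ] f x y ≡ ∑[ y ∈ ys ] ∑[ x ∈ xs ] f x y
∑-comm []       ys f = sym (∑-zero ys (λ _ → refl))
∑-comm (x ∷ xs) ys f = trans (cong (∑ ys (f x) +_) (∑-comm xs ys f))
                            (sym (∑-+ ys (f x) (λ y → ∑[ x ∈ xs ] f x y)))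

∑-pairs : ∀ xs (f : A → A → ℕ) → (∀ x y → f x y ≡ f y x) →
          2 * ∑ (pairs xs) (uncurry f) + ∑[ x ∈ xs ] f x x ≡ ∑[ x ∈ xs ] ∑[ y ∈ xs ] f x y
∑-pairs []       f f-sym = refl
∑-pairs (x ∷ xs) f f-sym = begin
  2 * ∑ (map (x ,_) xs ++ pairs xs) (uncurry f) + (f x x + diagonal)
    ≡⟨ cong (λ t → 2 * t + (f x x + diagonal)) (∑-++ (map (x ,_) xs) (pairs xs) (uncurry f)) ⟩
  2 * (∑ (map (x ,_) xs) (uncurry f) + rest) + (f x x + diagonal)
    ≡⟨ cong (λ t → 2 * (t + rest) + (f x x + diagonal)) (∑-map (x ,_) xs (uncurry f)) ⟩
  2 * (row + rest) + (f x x + diagonal)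
    ≡⟨ regroup row rest (f x x) diagonal ⟩
  (f x x + row) + (row + (2 * rest + diagonal))
    ≡⟨ cong₂ (λ a b → (f x x + row) + (a + b)) (∑-cong xs (λ {y} _ → f-sym x y)) (∑-pairs xs f f-sym) ⟩
  (f x x + row) + (∑[ y ∈ xs ] f y x + ∑[ y ∈ xs ] ∑[ z ∈ xs ] f y z)
    ≡⟨ cong ((f x x + row) +_) (∑-+ xs (λ y → f y x) (λ y → ∑ xs (f y))) ⟨
  (f x x + row) + ∑[ y ∈ xs ] (f y x + ∑ xs (f y)) ∎
  where
  open ≡-Reasoning
  row = ∑ xs (f x)
  rest = ∑ (pairs xs) (uncurry f)
  diagonal = ∑[ y ∈ xs ] f y y
  regroup : ∀ a r e d → 2 * (a + r) + (e + d) ≡ (e + a) + (a + (2 * r + d))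
  regroup = ℕ-Solver.solve-∀

prime⇒≢1 : ∀ {p} → Prime p → p ≢ 1
prime⇒≢1 p-prime = nonTrivial⇒≢1 {{prime⇒nonTrivial p-prime}}

coprime-*⁻ : ∀ {x} m {y} → Coprime x (m * y) → Coprime x y
coprime-*⁻ m coprime (i∣x , i∣y) = coprime (i∣x , ∣n⇒∣m*n m i∣y)

[coprime] : ℕ → ℕ → ℕ
[coprime] x y with coprime? x y
... | yes _ = 1
... | no _  = 0

[coprime]-cong : ∀ {x y u v} → (Coprime x y → Coprime u v) → (Coprime u v → Coprime x y) →
                 [coprime] x y ≡ [coprime] u v
[coprime]-cong {x} {y} {u} {v} to from with coprime? x y | coprime? u v
... | yes _ | yes _ = refl
... | no _  | no _  = refl
... | yes c | no ¬c = ⊥-elim (¬c (to c))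
... | no ¬c | yes c = ⊥-elim (¬c (from c))

[coprime]-sym : ∀ x y → [coprime] x y ≡ [coprime] y x
[coprime]-sym x y = [coprime]-cong Coprime.sym Coprime.sym

¬coprime⇒[coprime]≡0 : ∀ {x y} → ¬ Coprime x y → [coprime] x y ≡ 0
¬coprime⇒[coprime]≡0 {x} {y} ¬c with coprime? x y
... | yes c = ⊥-elim (¬c c)
... | no _  = refl

[coprime]-self : ∀ {x} → x ≢ 1 → [coprime] x x ≡ 0
[coprime]-self x≢1 = ¬coprime⇒[coprime]≡0 (λ c → x≢1 (c (∣-refl , ∣-refl)))

∑-[coprime]-diagonal : ∀ {xs} → Unique xs → 1 ∈ xs → ∑[ x ∈ xs ] [coprime] x x ≡ 1
∑-[coprime]-diagonal {_ ∷ xs} (1∉xs ∷ _) (here refl) =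
  cong suc (∑-zero xs (λ y∈ → [coprime]-self (All.lookup 1∉xs y∈ ∘ sym)))
∑-[coprime]-diagonal {_ ∷ xs} (x∉xs ∷ u) (there 1∈) =
  trans (cong (_+ ∑[ y ∈ xs ] [coprime] y y) ([coprime]-self (All.lookup x∉xs 1∈)))
        (∑-[coprime]-diagonal u 1∈)

coprimePairs : List ℕ → List ℕ → ℕ
coprimePairs xs ys = ∑[ x ∈ xs ] ∑[ y ∈ ys ] [coprime] x y

coprimePairs-++ˡ : ∀ xs ys zs → coprimePairs (xs ++ ys) zs ≡ coprimePairs xs zs + coprimePairs ys zs
coprimePairs-++ˡ xs ys zs = ∑-++ xs ys _

coprimePairs-++ʳ : ∀ xs ys zs → coprimePairs xs (ys ++ zs) ≡ coprimePairs xs ys + coprimePairs xs zs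
coprimePairs-++ʳ xs ys zs = trans (∑-cong xs (λ {x} _ → ∑-++ ys zs ([coprime] x))) (∑-+ xs _ _)

coprimePairs-comm : ∀ xs ys → coprimePairs xs ys ≡ coprimePairs ys xs
coprimePairs-comm xs ys =
  trans (∑-comm xs ys [coprime]) (∑-cong ys (λ {y} _ → ∑-cong xs (λ {x} _ → [coprime]-sym x y)))

coprimePairs-↭ : ∀ {xs ys} → xs ↭ ys → coprimePairs xs xs ≡ coprimePairs ys ys
coprimePairs-↭ {xs} xs↭ys = trans (∑-cong xs (λ {x} _ → ∑-↭ ([coprime] x) xs↭ys)) (∑-↭ _ xs↭ys)

powersTimes : ℕ → ℕ → List ℕ → List ℕ
powersTimes p zero    xs = xs
powersTimes p (suc k) xs = xs ++ map (p *_) (powersTimes p k xs)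

length-powersTimes : ∀ p k xs → length (powersTimes p k xs) ≡ suc k * length xs
length-powersTimes p zero    xs = sym (+-identityʳ _)
length-powersTimes p (suc k) xs =
  trans (length-++ xs) (cong (length xs +_) (trans (length-map (p *_) (powersTimes p k xs)) (length-powersTimes p k xs)))

∈-powersTimes⁻ : ∀ {p m xs} → (∀ {y} → y ∈ xs → y ∣ m) → ∀ k {x} → x ∈ powersTimes p k xs → x ∣ p ^ k * m
∈-powersTimes⁻ {m = m} xs-sound zero x∈ = subst (_ ∣_) (sym (*-identityˡ m)) (xs-sound x∈)
∈-powersTimes⁻ {p} {m} {xs} xs-sound (suc k) x∈ with ∈-++⁻ xs x∈
... | inj₁ x∈xs = ∣n⇒∣m*n (p ^ suc k) (xs-sound x∈xs)
... | inj₂ x∈pT with ∈-map⁻ (p *_) x∈pT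
...   | y , y∈ , refl = subst (p * y ∣_) (sym (*-assoc p (p ^ k) m)) (*-monoʳ-∣ p (∈-powersTimes⁻ xs-sound k y∈))

module _ {p : ℕ} (p-prime : Prime p) where

  private instance
    p≢0 : NonZero p
    p≢0 = prime⇒nonZero p-prime

  ∤⇒coprime : ∀ {x} → p ∤ x → Coprime x p
  ∤⇒coprime p∤x {i} (i∣x , i∣p) with prime⇒irreducible p-prime i∣p
  ... | inj₁ i≡1 = i≡1
  ... | inj₂ refl = contradiction i∣x p∤x

  ∣p^k*m⇒∣m : ∀ {x m} k → p ∤ x → x ∣ p ^ k * m → x ∣ m
  ∣p^k*m⇒∣m {x} {m} zero    p∤x x∣ = subst (x ∣_) (*-identityˡ m) x∣
  ∣p^k*m⇒∣m {x} {m} (suc k) p∤x x∣ =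
    ∣p^k*m⇒∣m k p∤x (coprime-divisor (∤⇒coprime p∤x) (subst (x ∣_) (*-assoc p (p ^ k) m) x∣))

  coprime-*⁺ : ∀ {x y} → p ∤ x → Coprime x y → Coprime x (p * y)
  coprime-*⁺ p∤x coprime (i∣x , i∣py) =
    coprime (i∣x , coprime-divisor (∤⇒coprime (λ p∣i → p∤x (∣-trans p∣i i∣x))) i∣py)

  ¬coprime-*-* : ∀ x y → ¬ Coprime (p * x) (p * y)
  ¬coprime-*-* x y coprime = prime⇒≢1 p-prime (coprime (m∣m*n x , m∣m*n y))

  ∤-^ : ∀ {q} → Prime q → p ≢ q → ∀ j → p ∤ q ^ j
  ∤-^ q-prime p≢q zero    p∣1 = prime⇒≢1 p-prime (∣1⇒≡1 p∣1)
  ∤-^ {q} q-prime p≢q (suc j) p∣q^j+1 with euclidsLemma q (q ^ j) p-prime p∣q^j+1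
  ... | inj₂ p∣q^j = ∤-^ q-prime p≢q j p∣q^j
  ... | inj₁ p∣q with prime⇒irreducible q-prime p∣q
  ...   | inj₁ p≡1 = prime⇒≢1 p-prime p≡1
  ...   | inj₂ p≡q = p≢q p≡q

  [coprime]-*ʳ : ∀ {x} → p ∤ x → ∀ y → [coprime] x (p * y) ≡ [coprime] x y
  [coprime]-*ʳ p∤x y = [coprime]-cong (coprime-*⁻ p) (coprime-*⁺ p∤x)

  coprimePairs-*ʳ : ∀ {xs} → All (p ∤_) xs → ∀ ys → coprimePairs xs (map (p *_) ys) ≡ coprimePairs xs ys
  coprimePairs-*ʳ {xs} p∤xs ys = ∑-cong xs λ {x} x∈ →
    trans (∑-map (p *_) ys ([coprime] x)) (∑-cong ys (λ {y} _ → [coprime]-*ʳ (All.lookup p∤xs x∈) y))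

  coprimePairs-*-* : ∀ xs ys → coprimePairs (map (p *_) xs) (map (p *_) ys) ≡ 0
  coprimePairs-*-* xs ys = trans (∑-map (p *_) xs _) (∑-zero xs λ {x} _ →
    trans (∑-map (p *_) ys _) (∑-zero ys λ {y} _ → ¬coprime⇒[coprime]≡0 (¬coprime-*-* x y)))

  ∈-powersTimes⁺ : ∀ {m xs} → (∀ {y} → y ∣ m → y ∈ xs) → ∀ k {x} → x ∣ p ^ k * m → x ∈ powersTimes p k xs
  ∈-powersTimes⁺ {m} xs-complete zero x∣ = xs-complete (subst (_ ∣_) (*-identityˡ m) x∣)
  ∈-powersTimes⁺ {m} {xs} xs-complete (suc k) {x} x∣ with p ∣? x
  ... | no p∤x = ∈-++⁺ˡ (xs-complete (∣p^k*m⇒∣m (suc k) p∤x x∣))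
  ... | yes (divides q refl) =
    ∈-++⁺ʳ xs (subst (_∈ map (p *_) (powersTimes p k xs)) (*-comm p q)
                   (∈-map⁺ (p *_) (∈-powersTimes⁺ xs-complete k q∣)))
    where
    q∣ : q ∣ p ^ k * m
    q∣ = *-cancelˡ-∣ p (subst₂ _∣_ (*-comm q p) (*-assoc p (p ^ k) m) x∣)

  powersTimes-unique : ∀ {xs} → Unique xs → All (p ∤_) xs → ∀ k → Unique (powersTimes p k xs)
  powersTimes-unique xs-unique p∤xs zero = xs-unique
  powersTimes-unique {xs} xs-unique p∤xs (suc k) =
    Unique.++⁺ xs-unique (Unique.map⁺ (λ {x} {y} → *-cancelˡ-≡ x y p) (powersTimes-unique xs-unique p∤xs k)) disjoint
    where
    disjoint : ∀ {x} → ¬ (x ∈ xs × x ∈ map (p *_) (powersTimes p k xs))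
    disjoint (x∈xs , x∈pT) with ∈-map⁻ (p *_) x∈pT
    ... | y , _ , refl = All.lookup p∤xs x∈xs (m∣m*n y)

  module _ {xs : List ℕ} (p∤xs : All (p ∤_) xs) where

    coprimePairs-powersTimesʳ : ∀ k → coprimePairs xs (powersTimes p k xs) ≡ suc k * coprimePairs xs xs
    coprimePairs-powersTimesʳ zero    = sym (+-identityʳ _)
    coprimePairs-powersTimesʳ (suc k) = trans (coprimePairs-++ʳ xs xs _)
      (cong (coprimePairs xs xs +_) (trans (coprimePairs-*ʳ p∤xs (powersTimes p k xs)) (coprimePairs-powersTimesʳ k)))

    coprimePairs-powersTimes : ∀ k →
      coprimePairs (powersTimes p k xs) (powersTimes p k xs) ≡ suc (2 * k) * coprimePairs xs xs
    coprimePairs-powersTimes zero    = sym (+-identityʳ _)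
    coprimePairs-powersTimes (suc k) = begin
      coprimePairs (xs ++ ys) (xs ++ ys)
        ≡⟨ coprimePairs-++ˡ xs ys (xs ++ ys) ⟩
      coprimePairs xs (xs ++ ys) + coprimePairs ys (xs ++ ys)
        ≡⟨ cong₂ _+_ (coprimePairs-++ʳ xs xs ys) (coprimePairs-++ʳ ys xs ys) ⟩
      (c + coprimePairs xs ys) + (coprimePairs ys xs + coprimePairs ys ys)
        ≡⟨ cong₂ (λ a b → (c + a) + (b + coprimePairs ys ys)) cross (trans (coprimePairs-comm ys xs) cross) ⟩
      (c + suc k * c) + (suc k * c + coprimePairs ys ys)
        ≡⟨ cong (λ z → (c + suc k * c) + (suc k * c + z)) (coprimePairs-*-* (powersTimes p k xs) (powersTimes p k xs)) ⟩
      (c + suc k * c) + (suc k * c + 0)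
        ≡⟨ collect k c ⟩
      suc (2 * suc k) * c ∎
      where
      open ≡-Reasoning
      ys = map (p *_) (powersTimes p k xs)
      c = coprimePairs xs xs
      cross : coprimePairs xs ys ≡ suc k * c
      cross = trans (coprimePairs-*ʳ p∤xs (powersTimes p k xs)) (coprimePairs-powersTimesʳ k)
      collect : ∀ k c → (c + suc k * c) + (suc k * c + 0) ≡ suc (2 * suc k) * c
      collect = ℕ-Solver.solve-∀

primePower : ℕ × ℕ → ℕ
primePower (p , k) = p ^ k

primePowerProduct : List (ℕ × ℕ) → ℕ
primePowerProduct fs = product (map primePower fs)

divisorList : List (ℕ × ℕ) → List ℕ
divisorList []             = 1 ∷ []
divisorList ((p , k) ∷ fs) = powersTimes p k (divisorList fs)

primePowerProduct-nonZero : ∀ {fs} → All (Prime ∘ proj₁) fs → NonZero (primePowerProduct fs)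
primePowerProduct-nonZero []                            = _
primePowerProduct-nonZero {(p , k) ∷ _} (p-prime ∷ ps) =
  m*n≢0 (p ^ k) _ {{m^n≢0 p k {{prime⇒nonZero p-prime}}}} {{primePowerProduct-nonZero ps}}

∤-primePowerProduct : ∀ {p} → Prime p → ∀ {fs} → All (Prime ∘ proj₁) fs → All (p ≢_) (map proj₁ fs) →
                      p ∤ primePowerProduct fs
∤-primePowerProduct p-prime []       []      p∣1 = prime⇒≢1 p-prime (∣1⇒≡1 p∣1)
∤-primePowerProduct p-prime {(q , j) ∷ fs} (q-prime ∷ ps) (p≢q ∷ p∉fs) p∣
  with euclidsLemma (q ^ j) (primePowerProduct fs) p-prime p∣
... | inj₁ p∣q^j  = ∤-^ p-prime q-prime p≢q j p∣q^j
... | inj₂ p∣rest = ∤-primePowerProduct p-prime ps p∉fs p∣rest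

divisorList-∣ : ∀ fs {x} → x ∈ divisorList fs → x ∣ primePowerProduct fs
divisorList-∣ []             (here refl) = ∣-refl
divisorList-∣ ((p , k) ∷ fs) x∈          = ∈-powersTimes⁻ (divisorList-∣ fs) k x∈

∣⇒∈-divisorList : ∀ {fs} → All (Prime ∘ proj₁) fs → ∀ {x} → x ∣ primePowerProduct fs → x ∈ divisorList fs
∣⇒∈-divisorList []                             x∣1 = here (∣1⇒≡1 x∣1)
∣⇒∈-divisorList {(p , k) ∷ fs} (p-prime ∷ ps) x∣  = ∈-powersTimes⁺ p-prime (∣⇒∈-divisorList ps) k x∣

divisorList-∤ : ∀ {p k fs} → All (Prime ∘ proj₁) ((p , k) ∷ fs) → Unique (map proj₁ ((p , k) ∷ fs)) →
                All (p ∤_) (divisorList fs)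
divisorList-∤ {fs = fs} (p-prime ∷ ps) (p∉fs ∷ _) =
  All.tabulate λ y∈ p∣y → ∤-primePowerProduct p-prime ps p∉fs (∣-trans p∣y (divisorList-∣ fs y∈))

divisorList-unique : ∀ {fs} → All (Prime ∘ proj₁) fs → Unique (map proj₁ fs) → Unique (divisorList fs)
divisorList-unique []              []              = [] ∷ []
divisorList-unique {(p , k) ∷ _} ps@(p-prime ∷ ps′) u@(_ ∷ u′) =
  powersTimes-unique p-prime (divisorList-unique ps′ u′) (divisorList-∤ ps u) k

length-divisorList : ∀ fs → length (divisorList fs) ≡ numDiv fs
length-divisorList []             = refl
length-divisorList ((p , k) ∷ fs) =
  trans (length-powersTimes p k (divisorList fs)) (cong (suc k *_) (length-divisorList fs))

coprimePairs-divisorList : ∀ {fs} → All (Prime ∘ proj₁) fs → Unique (map proj₁ fs) →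
                           coprimePairs (divisorList fs) (divisorList fs) ≡ prodOdd fs
coprimePairs-divisorList []              []              = refl
coprimePairs-divisorList {(p , k) ∷ _} ps@(p-prime ∷ ps′) u@(_ ∷ u′) =
  trans (coprimePairs-powersTimes p-prime (divisorList-∤ ps u) k)
        (cong (suc (2 * k) *_) (coprimePairs-divisorList ps′ u′))

∈-Divisors⁻ : ∀ {n x} → x ∈ Divisors n → x ∣ n
∈-Divisors⁻ {n} x∈ = proj₂ (∈-filter⁻ (_∣? n) {xs = applyUpTo suc n} x∈)

∈-Divisors⁺ : ∀ {n x} .{{_ : NonZero n}} → x ∣ n → x ∈ Divisors n
∈-Divisors⁺ {n} {zero}  0∣n = contradiction (0∣⇒≡0 0∣n) (≢-nonZero⁻¹ n)
∈-Divisors⁺ {n} {suc x} x∣n = ∈-filter⁺ (_∣? n) (∈-applyUpTo⁺ suc (∣⇒≤ x∣n)) x∣n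

Divisors-unique : ∀ n → Unique (Divisors n)
Divisors-unique n =
  Unique.filter⁺ (_∣? n) (Unique.applyUpTo⁺₁ suc n (λ i<j _ i+1≡j+1 → <⇒≢ i<j (suc-injective i+1≡j+1)))

Divisors-↭ : ∀ {n ys} .{{_ : NonZero n}} → Unique ys →
             (∀ {x} → x ∈ ys → x ∣ n) → (∀ {x} → x ∣ n → x ∈ ys) → Divisors n ↭ ys
Divisors-↭ {n} ys-unique sound complete = ∼bag⇒↭ (unique∧set⇒bag (Divisors-unique n) ys-unique
  (mk⇔ (λ x∈ → complete (∈-Divisors⁻ x∈)) (λ x∈ → ∈-Divisors⁺ (sound x∈))))

dist : ℕ → ℕ → ℕ
dist x y with coprime? x y
... | yes _ = 1
... | no _  = 2

dist-isDistance : ∀ n → 1 ∈ Divisors n → IsDistance n dist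
dist-isDistance n 1∈ u v u∈ v∈ u≢v with coprime? u v
... | yes coprime = step (u∈ , v∈ , u≢v , coprime⇒gcd≡1 coprime) here , shortest
  where
  shortest : ∀ k → Walk n u v k → 1 ≤ k
  shortest zero    here = contradiction refl u≢v
  shortest (suc k) _    = s≤s z≤n
... | no ¬coprime = step (u∈ , 1∈ , u≢1 , gcd-zeroʳ u) (step (1∈ , v∈ , 1≢v , gcd-zeroˡ v) here) , shortest
  where
  u≢1 : u ≢ 1
  u≢1 refl = ¬coprime (1-coprimeTo v)
  1≢v : 1 ≢ v
  1≢v refl = ¬coprime (Coprime.sym (1-coprimeTo u))
  shortest : ∀ k → Walk n u v k → 2 ≤ k
  shortest zero          here                          = contradiction refl u≢v
  shortest 1             (step (_ , _ , _ , gcd≡1) here) = ⊥-elim (¬coprime (gcd≡1⇒coprime gcd≡1))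
  shortest (suc (suc k)) _                             = s≤s (s≤s z≤n)

/-cross : ∀ {i j d e} → i ℤ.* ℤ.+ suc e ≡ j ℤ.* ℤ.+ suc d → i / suc d ≡ j / suc e
/-cross {i} {j} {d} {e} i*e≡j*d = ℚ.fromℚᵘ-cong {mkℚᵘ i d} {mkℚᵘ j e} (*≡* i*e≡j*d)

/-+ : ∀ i j d → i / suc d ℚ.+ j / suc d ≡ (i ℤ.+ j) / suc d
/-+ i j d = ℚ.toℚᵘ-injective (begin
  ℚ.toℚᵘ (i / suc d ℚ.+ j / suc d)
    ≈⟨ ℚ.toℚᵘ-homo-+ (i / suc d) (j / suc d) ⟩
  ℚ.toℚᵘ (i / suc d) ℚᵘ.+ ℚ.toℚᵘ (j / suc d)
    ≈⟨ ℚᵘ.+-cong (ℚ.toℚᵘ-fromℚᵘ (mkℚᵘ i d)) (ℚ.toℚᵘ-fromℚᵘ (mkℚᵘ j d)) ⟩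
  mkℚᵘ i d ℚᵘ.+ mkℚᵘ j d
    ≈⟨ *≡* (trans (common-denominator i j (ℤ.+ suc d)) (cong ((i ℤ.+ j) ℤ.*_) (sym (ℤ.pos-* (suc d) (suc d))))) ⟩
  mkℚᵘ (i ℤ.+ j) d
    ≈⟨ ℚ.toℚᵘ-fromℚᵘ (mkℚᵘ (i ℤ.+ j) d) ⟨
  ℚ.toℚᵘ ((i ℤ.+ j) / suc d) ∎)
  where
  open ℚᵘ.≃-Reasoning
  common-denominator : ∀ i j e → (i ℤ.* e ℤ.+ j ℤ.* e) ℤ.* e ≡ (i ℤ.+ j) ℤ.* (e ℤ.* e)
  common-denominator = ℤ-Solver.solve-∀

sumℚ-map-/ : ∀ (f : A → ℕ) d xs → sumℚ (map (λ x → ℤ.+ f x / suc d) xs) ≡ ℤ.+ ∑ xs f / suc d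
sumℚ-map-/ f d []       = /-cross {ℤ.+ 0} {ℤ.+ 0} {0} {d} refl
sumℚ-map-/ f d (x ∷ xs) =
  trans (cong (ℤ.+ f x / suc d ℚ.+_) (sumℚ-map-/ f d xs)) (/-+ (ℤ.+ f x) (ℤ.+ ∑ xs f) d)

coprimeWeight : ℕ → ℕ → ℕ
coprimeWeight x y = 1 + [coprime] x y

recip-dist : ∀ x y → recip (dist x y) ≡ ℤ.+ coprimeWeight x y / 2
recip-dist x y with coprime? x y
... | yes _ = refl
... | no _  = refl

∑-pairs-coprimeWeight : ∀ {xs} → Unique xs → 1 ∈ xs →
  2 * ∑ (pairs xs) (uncurry coprimeWeight) + suc (length xs) ≡ length xs * length xs + coprimePairs xs xs
∑-pairs-coprimeWeight {xs} xs-unique 1∈ = begin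
  2 * weights + suc (length xs)
    ≡⟨ cong (2 * weights +_) diagonal ⟨
  2 * weights + ∑[ x ∈ xs ] coprimeWeight x x
    ≡⟨ ∑-pairs xs coprimeWeight (λ x y → cong suc ([coprime]-sym x y)) ⟩
  ∑[ x ∈ xs ] ∑[ y ∈ xs ] coprimeWeight x y
    ≡⟨ ∑-cong xs (λ {x} _ → ∑-+ xs (λ _ → 1) ([coprime] x)) ⟩
  ∑[ x ∈ xs ] (∑[ y ∈ xs ] 1 + ∑[ y ∈ xs ] [coprime] x y)
    ≡⟨ ∑-+ xs (λ _ → ∑[ y ∈ xs ] 1) (λ x → ∑[ y ∈ xs ] [coprime] x y) ⟩
  ∑[ x ∈ xs ] ∑[ y ∈ xs ] 1 + coprimePairs xs xs
    ≡⟨ cong (_+ coprimePairs xs xs) (trans (∑-const xs _) (cong (length xs *_) ∑-one)) ⟩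
  length xs * length xs + coprimePairs xs xs ∎
  where
  open ≡-Reasoning
  weights = ∑ (pairs xs) (uncurry coprimeWeight)
  ∑-one : ∑[ x ∈ xs ] 1 ≡ length xs
  ∑-one = trans (∑-const xs 1) (*-identityʳ (length xs))
  diagonal : ∑[ x ∈ xs ] coprimeWeight x x ≡ suc (length xs)
  diagonal = trans (∑-+ xs (λ _ → 1) (λ x → [coprime] x x))
                   (trans (cong₂ _+_ ∑-one (∑-[coprime]-diagonal xs-unique 1∈)) (+-comm (length xs) 1))

hararyNumerator : ℕ → ℕ → ℤ
hararyNumerator D C = (ℤ.+ D ℤ.* (ℤ.+ D ℤ.- ℤ.+ 1)) ℤ.+ ℤ.+ C ℤ.- ℤ.+ 1

hararyFromCounts : ℕ → ℕ → ℚ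
hararyFromCounts D C = hararyNumerator D C / 4

harary-numerator : ∀ {S D C} → 2 * S + suc D ≡ D * D + C →
  ℤ.+ S ℤ.* ℤ.+ 4 ≡ hararyNumerator D C ℤ.* ℤ.+ 2
harary-numerator {S} {D} {C} counted = begin
  ℤ.+ S ℤ.* ℤ.+ 4
    ≡⟨ cancel (ℤ.+ S) (ℤ.+ suc D) ⟩
  (ℤ.+ 2 ℤ.* ℤ.+ S ℤ.+ ℤ.+ suc D ℤ.- ℤ.+ suc D) ℤ.* ℤ.+ 2
    ≡⟨ cong (λ t → (t ℤ.+ ℤ.+ suc D ℤ.- ℤ.+ suc D) ℤ.* ℤ.+ 2) (ℤ.pos-* 2 S) ⟨
  (ℤ.+ (2 * S + suc D) ℤ.- ℤ.+ suc D) ℤ.* ℤ.+ 2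
    ≡⟨ cong (λ t → (ℤ.+ t ℤ.- ℤ.+ suc D) ℤ.* ℤ.+ 2) counted ⟩
  (ℤ.+ (D * D) ℤ.+ ℤ.+ C ℤ.- ℤ.+ suc D) ℤ.* ℤ.+ 2
    ≡⟨ cong (λ t → (t ℤ.+ ℤ.+ C ℤ.- ℤ.+ suc D) ℤ.* ℤ.+ 2) (ℤ.pos-* D D) ⟩
  (ℤ.+ D ℤ.* ℤ.+ D ℤ.+ ℤ.+ C ℤ.- (ℤ.+ 1 ℤ.+ ℤ.+ D)) ℤ.* ℤ.+ 2
    ≡⟨ expand (ℤ.+ D) (ℤ.+ C) ⟩
  hararyNumerator D C ℤ.* ℤ.+ 2 ∎
  where
  open ≡-Reasoning
  cancel : ∀ s e → s ℤ.* ℤ.+ 4 ≡ (ℤ.+ 2 ℤ.* s ℤ.+ e ℤ.- e) ℤ.* ℤ.+ 2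
  cancel = ℤ-Solver.solve-∀
  expand : ∀ d c → (d ℤ.* d ℤ.+ c ℤ.- (ℤ.+ 1 ℤ.+ d)) ℤ.* ℤ.+ 2 ≡
                   (d ℤ.* (d ℤ.- ℤ.+ 1) ℤ.+ c ℤ.- ℤ.+ 1) ℤ.* ℤ.+ 2
  expand = ℤ-Solver.solve-∀

Harary-dist≡hararyFromCounts : ∀ n → 1 ∈ Divisors n →
  Harary n dist ≡ hararyFromCounts (length (Divisors n)) (coprimePairs (Divisors n) (Divisors n))
Harary-dist≡hararyFromCounts n 1∈ = begin
  Harary n dist
    ≡⟨ cong sumℚ (map-cong (λ (x , y) → recip-dist x y) (pairs L)) ⟩
  sumℚ (map (λ e → ℤ.+ uncurry coprimeWeight e / 2) (pairs L))
    ≡⟨ sumℚ-map-/ (uncurry coprimeWeight) 1 (pairs L) ⟩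
  ℤ.+ weights / 2
    ≡⟨ /-cross {ℤ.+ weights} {hararyNumerator (length L) (coprimePairs L L)}
               (harary-numerator {weights} (∑-pairs-coprimeWeight (Divisors-unique n) 1∈)) ⟩
  hararyFromCounts (length L) (coprimePairs L L) ∎
  where
  open ≡-Reasoning
  L = Divisors n
  weights = ∑ (pairs L) (uncurry coprimeWeight)

theorem3p2 : (n : ℕ) (fs : List (ℕ × ℕ)) → IsPrimeFactorization n fs →
    ∃[ d ] (IsDistance n d × Harary n d ≡ hararyFormula fs)
theorem3p2 n fs (prime-exponents , distinct , n≡∏) = dist , dist-isDistance n 1∈ , (begin
  Harary n dist
    ≡⟨ Harary-dist≡hararyFromCounts n 1∈ ⟩
  hararyFromCounts (length (Divisors n)) (coprimePairs (Divisors n) (Divisors n))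
    ≡⟨ cong₂ hararyFromCounts (trans (↭.↭-length σ) (length-divisorList fs))
                              (trans (coprimePairs-↭ σ) (coprimePairs-divisorList primes distinct)) ⟩
  hararyFormula fs ∎)
  where
  open ≡-Reasoning
  primes : All (Prime ∘ proj₁) fs
  primes = All.map proj₁ prime-exponents
  n≡product : n ≡ primePowerProduct fs
  n≡product = n≡∏
  instance
    n≢0 : NonZero n
    n≢0 = subst NonZero (sym n≡product) (primePowerProduct-nonZero primes)
  1∈ : 1 ∈ Divisors n
  1∈ = ∈-Divisors⁺ (1∣ n)
  σ : Divisors n ↭ divisorList fs
  σ = Divisors-↭ (divisorList-unique primes distinct)
        (λ x∈ → subst (_ ∣_) (sym n≡product) (divisorList-∣ fs x∈))
        (λ x∣n → ∣⇒∈-divisorList primes (subst (_ ∣_) n≡product x∣n))
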